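{- A Chu space $\mathsf{F}=(B,s,Y)$ over $\Sigma$ is a finite object of $\mathbf{iC}$ if and only if $B$ is finite and $\mathsf{F}$ is extensional. In this case $|Y|\le|\Sigma|^{|B|}$; in particular, if $\Sigma$ is finite then $Y$ is finite.
   Context: $\Sigma$ is a set (possibly infinite) containing at least two distinct elements, denoted $0$ and $1$. A Chu space over $\Sigma$ is a triple $(A,r,X)$ with sets $A,X$ and a function $r:A\times X\to\Sigma$. A morphism $\varphi=(\varphi^+,\varphi^-):(A,r,X)\to(B,s,Y)$ consists of functions $\varphi^+:A\to B$, $\varphi^-:Y\to X$ with $s(\varphi^+(a),y)=r(a,\varphi^-(y))$ for all $a,y$; composition is $\varphi_2\circ\varphi_1=(\varphi_2^+\circ\varphi_1^+,\varphi_1^-\circ\varphi_2^-)$. $(A,r,X)$ is extensional if for $x,y\in X$, $r(-,x)=r(-,y)$ implies $x=y$. $\mathbf{C}$ is the category of all Chu spaces over $\Sigma$, and $\mathbf{iC}$ its subcategory with the same objects whose morphisms are the monomorphisms of $\mathbf{C}$. An $\omega$-sequence in $\mathbf{iC}$ is a family of objects $\mathsf{C}_i$ and $\mathbf{iC}$-morphisms $\varphi_i:\mathsf{C}_i\to\mathsf{C}_{i+1}$ ($i\ge1$); a cocone to $\mathsf{C}$ is a family of $\mathbf{iC}$-morphisms $\psi_i:\mathsf{C}_i\to\mathsf{C}$ with $\psi_{i+1}\circ\varphi_i=\psi_i$; it is a colimit in $\mathbf{iC}$ if for every cocone $(\psi'_i:\mathsf{C}_i\to\mathsf{C}')$ in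 $\mathbf{iC}$ there is a unique $\mathbf{iC}$-morphism $\psi:\mathsf{C}\to\mathsf{C}'$ with $\psi\circ\psi_i=\psi'_i$. An object $\mathsf{F}$ of $\mathbf{iC}$ is a finite object of $\mathbf{iC}$ if for every $\omega$-sequence $(\mathsf{C}_i,\varphi_i)$ in $\mathbf{iC}$ having a colimit $(\psi_i:\mathsf{C}_i\to\mathsf{C})$ in $\mathbf{iC}$ and every $\mathbf{iC}$-morphism $\varphi:\mathsf{F}\to\mathsf{C}$, there exist $i\ge1$ and an $\mathbf{iC}$-morphism $\psi:\mathsf{F}\to\mathsf{C}_i$ with $\varphi=\psi_i\circ\psi$. -}

module Defs where

open import Data.Nat using (ℕ; suc)
open import Data.Fin using (Fin)
open import Data.Product using (Σ; _×_; _,_)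
open import Function.Bundles using (_↔_)
open import Relation.Binary.PropositionalEquality using (_≡_)

Finite : Set → Set
Finite B = Σ ℕ λ n → B ↔ Fin n

-- Chu spaces over an alphabet 𝕊 (the paper's Σ).
module ChuDefs (𝕊 : Set) where

  record Chu : Set₁ where
    constructor chu
    field
      A : Set
      X : Set
      r : A → X → 𝕊
  open Chu public

  record Hom (C D : Chu) : Set where
    constructor hom
    field
      f⁺ : A C → A D
      f⁻ : X D → X C
      adj : ∀ a y → r D (f⁺ a) y ≡ r C a (f⁻ y)
  open Hom public

  _≈_ : ∀ {C D} → Hom C D → Hom C D → Set
  φ ≈ ψ = (∀ a → f⁺ φ a ≡ f⁺ ψ a) × (∀ y → f⁻ φ y ≡ f⁻ ψ y)

  _∘_ : ∀ {C D E} → Hom D E → Hom C D → Hom C E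
  _∘_ {C} {D} {E} φ₂ φ₁ = record
    { f⁺ = λ a → f⁺ φ₂ (f⁺ φ₁ a)
    ; f⁻ = λ y → f⁻ φ₁ (f⁻ φ₂ y)
    ; adj = λ a y → Eq.trans (adj φ₂ (f⁺ φ₁ a) y) (adj φ₁ a (f⁻ φ₂ y))
    }
    where import Relation.Binary.PropositionalEquality as Eq

  IsMono : ∀ {C D} → Hom C D → Set₁
  IsMono {C} {D} φ = ∀ {Z : Chu} (g h : Hom Z C) → (φ ∘ g) ≈ (φ ∘ h) → g ≈ h

  record iHom (C D : Chu) : Set₁ where
    constructor ihom
    field
      mor  : Hom C D
      mono : IsMono mor
  open iHom public

  Extensional : Chu → Set
  Extensional C = ∀ (x y : X C) → (∀ a → r C a x ≡ r C a y) → x ≡ y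

  -- ω-sequences in iC (indexed from 0 instead of 1)
  record ωSeq : Set₁ where
    field
      obj  : ℕ → Chu
      step : ∀ i → iHom (obj i) (obj (suc i))
  open ωSeq public

  record Cocone (S : ωSeq) (C : Chu) : Set₁ where
    field
      leg : ∀ i → iHom (obj S i) C
      commute : ∀ i → (mor (leg (suc i)) ∘ mor (step S i)) ≈ mor (leg i)
  open Cocone public

  IsColimit : (S : ωSeq) (C : Chu) → Cocone S C → Set₁
  IsColimit S C cc =
    ∀ (C' : Chu) (cc' : Cocone S C') →
      Σ (iHom C C') λ ψ →
        (∀ i → (mor ψ ∘ mor (leg cc i)) ≈ mor (leg cc' i))
        × (∀ (ψ' : iHom C C') →
             (∀ i → (mor ψ' ∘ mor (leg cc i)) ≈ mor (leg cc' i)) →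
             mor ψ' ≈ mor ψ)

  FiniteObject : Chu → Set₁
  FiniteObject F =
    ∀ (S : ωSeq) (C : Chu) (cc : Cocone S C) → IsColimit S C cc →
      (φ : iHom F C) →
      Σ ℕ λ i → Σ (iHom F (obj S i)) λ ψ → mor φ ≈ (mor (leg cc i) ∘ mor ψ)

-- Classically, the monomorphisms of C are the morphisms injective on points and surjective on
-- states, so a colimit in iC is a union on points and an inverse limit on states.
--
-- If B is infinite it contains an injective sequence g, and F is the colimit of its restrictions
-- to B ∖ {g i, g (i + 1), …}; the identity of F factors through none of them.  If two states
-- x₀ ≠ y₀ have the same column, F embeds into the colimit of copies of F whose states at stage k
-- are tagged with a pair (j , b) whose bit b is visible only if j < k; sending (x₀ , i , true)
-- to y₀ and (x₀ , i , false) to x₀ prevents a factorisation through stage i.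
-- Conversely, each of the finitely many points of F enters a colimit at some stage, hence all of
-- them enter through a single leg, and extensionality makes the states follow.  Finally, extensionality embeds
-- the states into the columns B → 𝕊.

module Submission where

open import Defs
open import Level using (0ℓ)
open import Axiom.ExcludedMiddle using (ExcludedMiddle)
open import Data.Bool using (Bool; true; false; T)
open import Data.Bool.Properties using (T-irrelevant; T-≡)
open import Data.Empty using (⊥; ⊥-elim)
open import Data.Fin using (Fin; zero; suc; toℕ; funToFin; finToFun)
open import Data.Fin.Properties using (pigeonhole; toℕ-injective; finToFun-funToFin)
import Data.Fin.Properties as Fin
open import Data.Nat
  using (ℕ; zero; suc; _≤_; _<_; _≤′_; ≤′-refl; ≤′-step; _^_; _⊔_; s≤s; _≤?_)
open import Data.Nat.Properties
  using ( ≤⇒≤′; ≤′⇒≤; ≰⇒>; ≤-refl; ≤-trans; n≤1+n; n<1+n; m≤m⊔n; m≤n⊔m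
        ; m<1+n⇒m<n∨m≡n; <-cmp; <-irrefl)
open import Data.Product using (Σ; _×_; _,_; proj₁; proj₂; map₂)
open import Data.Sum using (_⊎_; inj₁; inj₂)
open import Data.Unit using (⊤; tt)
open import Data.Vec.Functional using (_∷_)
open import Function.Bundles using (Inverse; Equivalence; _⇔_; _↣_; mk↔ₛ′; mk↣; mk⇔)
open import Function.Definitions using (Injective; StrictlySurjective)
open import Relation.Binary.Definitions using (tri<; tri≈; tri>)
open import Relation.Nullary using (¬_; yes; no)
open import Relation.Nullary.Decidable using (True; isYes; toWitness; fromWitness)
open import Relation.Binary.PropositionalEquality
  using (_≡_; _≢_; refl; sym; trans; cong; cong₂; subst)
open Relation.Binary.PropositionalEquality.≡-Reasoning

finite-bounded : ∀ {B} → Finite B → (f : B → ℕ) → Σ ℕ λ M → ∀ b → f b ≤ M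
finite-bounded (n , B↔Fin) f = proj₁ (bounded n (λ i → f (from i))) , λ b →
  subst (λ b′ → f b′ ≤ _) (strictlyInverseʳ b) (proj₂ (bounded n (λ i → f (from i))) (to b))
  where
  open Inverse B↔Fin
  bounded : ∀ n (g : Fin n → ℕ) → Σ ℕ λ M → ∀ i → g i ≤ M
  bounded zero    g = 0 , λ ()
  bounded (suc n) g with bounded n (λ i → g (suc i))
  ... | M , bound = g zero ⊔ M , λ { zero → m≤m⊔n (g zero) M
                                   ; (suc i) → ≤-trans (bound i) (m≤n⊔m (g zero) M) }

record Exhaustion (B : Set) : Set₁ where
  field
    Part           : ℕ → Set
    incl           : ∀ i → Part i → B
    incl-injective : ∀ i → Injective _≡_ _≡_ (incl i)
    next           : ∀ i → Part i → Part (suc i)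
    incl-next      : ∀ i a → incl (suc i) (next i a) ≡ incl i a
    covering       : ∀ b → Σ ℕ λ i → Σ (Part i) λ a → incl i a ≡ b

  by-stage : {P : B → Set} → (∀ i a → P (incl i a)) → ∀ b → P b
  by-stage {P} p b = subst P (proj₂ (proj₂ (covering b))) (p _ _)

record InverseLimit : Set₁ where
  field
    Stage              : ℕ → Set
    Limit              : Set
    restrict           : ∀ k → Stage (suc k) → Stage k
    project            : ∀ k → Limit → Stage k
    restrict-project   : ∀ k l → restrict k (project (suc k) l) ≡ project k l
    project-surjective : ∀ k → StrictlySurjective _≡_ (project k)
    complete           : (z : ∀ k → Stage k) → (∀ k → restrict k (z (suc k)) ≡ z k) →
                         Σ Limit λ l → ∀ k → project k l ≡ z k
    separated          : ∀ l → Σ ℕ λ k → ∀ l′ → project k l′ ≡ project k l → l′ ≡ l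

  restrict-surjective : ∀ k → StrictlySurjective _≡_ (restrict k)
  restrict-surjective k z with project-surjective k z
  ... | l , eq = project (suc k) l , trans (restrict-project k l) eq

-- Bit k j is the bit of a pair (j , b) as seen at stage k: Bool if j < k, ⊤ otherwise.
Bit : ℕ → ℕ → Set
Bit zero    j       = ⊤
Bit (suc k) zero    = Bool
Bit (suc k) (suc j) = Bit k j

hide : ∀ k j → Bool → Bit k j
hide zero    j       b = tt
hide (suc k) zero    b = b
hide (suc k) (suc j) b = hide k j b

-- An invisible bit is read as false.
reveal : ∀ k j → Bit k j → Bool
reveal zero    j       c = false
reveal (suc k) zero    b = b
reveal (suc k) (suc j) c = reveal k j c

forget : ∀ k j → Bit (suc k) j → Bit k j
forget zero    j       c = tt
forget (suc k) zero    b = b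
forget (suc k) (suc j) c = forget k j c

forget-hide : ∀ k j b → forget k j (hide (suc k) j b) ≡ hide k j b
forget-hide zero    j       b = refl
forget-hide (suc k) zero    b = refl
forget-hide (suc k) (suc j) b = forget-hide k j b

hide-reveal : ∀ k j c → hide k j (reveal k j c) ≡ c
hide-reveal zero    j       c = refl
hide-reveal (suc k) zero    b = refl
hide-reveal (suc k) (suc j) c = hide-reveal k j c

reveal-hide : ∀ {k j} b → j < k → reveal k j (hide k j b) ≡ b
reveal-hide {suc k} {zero}  b _         = refl
reveal-hide {suc k} {suc j} b (s≤s j<k) = reveal-hide b j<k

reveal-forget : ∀ {k j} c → j < k → reveal k j (forget k j c) ≡ reveal (suc k) j c
reveal-forget {suc k} {zero}  b _         = refl
reveal-forget {suc k} {suc j} c (s≤s j<k) = reveal-forget c j<k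

hide-invisible : ∀ {k j} b b′ → k ≤ j → hide k j b ≡ hide k j b′
hide-invisible {zero}          b b′ _         = refl
hide-invisible {suc k} {suc j} b b′ (s≤s k≤j) = hide-invisible b b′ k≤j

-- The stages of an inverse sequence with limit ℕ × Bool.
Blurred : ℕ → Set
Blurred k = Σ ℕ (Bit k)

blur : ∀ k → ℕ × Bool → Blurred k
blur k (j , b) = j , hide k j b

coarsen : ∀ k → Blurred (suc k) → Blurred k
coarsen k (j , c) = j , forget k j c

revealed : ∀ k → Blurred k → Bool
revealed k (j , c) = reveal k j c

coarsen-blur : ∀ k l → coarsen k (blur (suc k) l) ≡ blur k l
coarsen-blur k (j , b) = cong (j ,_) (forget-hide k j b)

blur-revealed : ∀ k z → blur k (proj₁ z , revealed k z) ≡ z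
blur-revealed k (j , c) = cong (j ,_) (hide-reveal k j c)

blur-surjective : ∀ k → StrictlySurjective _≡_ (blur k)
blur-surjective k z = (proj₁ z , revealed k z) , blur-revealed k z

blur-invisible : ∀ {k j} b b′ → k ≤ j → blur k (j , b) ≡ blur k (j , b′)
blur-invisible {k} {j} b b′ k≤j = cong (j ,_) (hide-invisible b b′ k≤j)

blur-separates : ∀ {j} b l → blur (suc j) l ≡ blur (suc j) (j , b) → l ≡ (j , b)
blur-separates {j} b (j′ , b′) eq with cong proj₁ eq
... | refl = cong (j ,_) (trans (sym (reveal-hide b′ (n<1+n j)))
                           (trans (cong (revealed (suc j)) eq) (reveal-hide b (n<1+n j))))

module _ (z : ∀ k → Blurred k) (z-coherent : ∀ k → coarsen k (z (suc k)) ≡ z k) where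

  private
    j : ℕ
    j = proj₁ (z 0)

    index-constant : ∀ k → proj₁ (z k) ≡ j
    index-constant zero    = refl
    index-constant (suc k) = trans (cong proj₁ (z-coherent k)) (index-constant k)

    b : Bool
    b = revealed (suc j) (z (suc j))

    bit-settled : ∀ {k} → suc j ≤′ k → revealed k (z k) ≡ b
    bit-settled ≤′-refl = refl
    bit-settled {suc k} (≤′-step j<k) = begin
      revealed (suc k) (z (suc k))       ≡⟨ sym (reveal-forget (proj₂ (z (suc k))) index<k) ⟩
      revealed k (coarsen k (z (suc k))) ≡⟨ cong (revealed k) (z-coherent k) ⟩
      revealed k (z k)                   ≡⟨ bit-settled j<k ⟩
      b                                  ∎
      where
      index<k : proj₁ (z (suc k)) < k
      index<k = subst (_< k) (sym (index-constant (suc k))) (≤′⇒≤ j<k)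

  blur-complete : Σ (ℕ × Bool) λ l → ∀ k → blur k l ≡ z k
  blur-complete = (j , b) , λ k → trans (agrees k) (blur-revealed k (z k))
    where
    agrees : ∀ k → blur k (j , b) ≡ blur k (proj₁ (z k) , revealed k (z k))
    agrees k with k ≤? j
    ... | yes k≤j = trans (blur-invisible b (revealed k (z k)) k≤j)
                          (cong (λ i → blur k (i , revealed k (z k))) (sym (index-constant k)))
    ... | no  k≰j = cong₂ (λ i c → blur k (i , c))
                          (sym (index-constant k)) (sym (bit-settled (≤⇒≤′ (≰⇒> k≰j))))

blurring : InverseLimit
blurring = record
  { Stage              = Blurred
  ; Limit              = ℕ × Bool
  ; restrict           = coarsen
  ; project            = blur
  ; restrict-project   = coarsen-blur
  ; project-surjective = blur-surjective
  ; complete           = blur-complete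
  ; separated          = λ { (j , b) → suc j , λ l → blur-separates b l }
  }

module Classical (lem : ExcludedMiddle 0ℓ) where

  -- Deciding membership makes it proof-irrelevant, so the first projection is injective.
  Sub : {B : Set} → (B → Set) → Set
  Sub {B} P = Σ B λ b → True (lem {P b})

  Sub-≡ : ∀ {B} {P : B → Set} {u v : Sub P} → proj₁ u ≡ proj₁ v → u ≡ v
  Sub-≡ {u = b , p} {v = .b , q} refl = cong (b ,_) (T-irrelevant p q)

  module _ {B : Set} (infinite : ¬ Finite B) where

    fresh : ∀ {n} (e : Fin n → B) → Injective _≡_ _≡_ e → Σ B λ b → ∀ j → e j ≢ b
    fresh {n} e e-injective with lem {Σ B λ b → ∀ j → e j ≢ b}
    ... | yes b = b
    ... | no none = ⊥-elim (infinite (n , mk↔ₛ′ (λ b → proj₁ (hit b)) e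
                                         (λ j → e-injective (proj₂ (hit (e j))))
                                         (λ b → proj₂ (hit b))))
      where
      hit : ∀ b → Σ (Fin n) λ j → e j ≡ b
      hit b with lem {Σ (Fin n) λ j → e j ≡ b}
      ... | yes h = h
      ... | no ¬h = ⊥-elim (none (b , λ j eq → ¬h (j , eq)))

    enumerate : ∀ n → Σ (Fin n → B) (Injective _≡_ _≡_)
    enumerate zero    = (λ ()) , λ { {()} }
    enumerate (suc n) = b ∷ e , ∷-injective
      where
      e : Fin n → B
      e = proj₁ (enumerate n)
      b : B
      b = proj₁ (fresh e (proj₂ (enumerate n)))
      b-fresh : ∀ j → e j ≢ b
      b-fresh = proj₂ (fresh e (proj₂ (enumerate n)))
      ∷-injective : Injective _≡_ _≡_ (b ∷ e)
      ∷-injective {zero}  {zero}  _  = refl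
      ∷-injective {zero}  {suc j} eq = ⊥-elim (b-fresh j (sym eq))
      ∷-injective {suc i} {zero}  eq = ⊥-elim (b-fresh i eq)
      ∷-injective {suc i} {suc j} eq = cong suc (proj₂ (enumerate n) eq)

    sequence : ℕ → B
    sequence n = proj₁ (enumerate (suc n)) zero

    sequence-enumerated : ∀ {m n} → m < n → Σ (Fin n) λ j → proj₁ (enumerate n) j ≡ sequence m
    sequence-enumerated {m} {suc n} m<1+n with m<1+n⇒m<n∨m≡n m<1+n
    ... | inj₂ refl = zero , refl
    ... | inj₁ m<n  = suc (proj₁ (sequence-enumerated m<n)) , proj₂ (sequence-enumerated m<n)

    sequence-injective : Injective _≡_ _≡_ sequence
    sequence-injective {m} {n} eq with <-cmp m n
    ... | tri≈ _ m≡n _ = m≡n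
    ... | tri< m<n _ _ = let j , hit = sequence-enumerated m<n in
                         ⊥-elim (proj₂ (fresh _ (proj₂ (enumerate n))) j (trans hit eq))
    ... | tri> _ _ n<m = let j , hit = sequence-enumerated n<m in
                         ⊥-elim (proj₂ (fresh _ (proj₂ (enumerate m))) j (trans hit (sym eq)))

  finite⊎ℕ-injection : (B : Set) → Finite B ⊎ Σ (ℕ → B) (Injective _≡_ _≡_)
  finite⊎ℕ-injection B with lem {Finite B}
  ... | yes finite   = inj₁ finite
  ... | no  infinite = inj₂ (sequence infinite , sequence-injective infinite)

  injection-into-Fin⇒finite : ∀ {B N} (f : B → Fin N) → Injective _≡_ _≡_ f → Finite B
  injection-into-Fin⇒finite {B} {N} f f-injective with finite⊎ℕ-injection B
  ... | inj₁ finite = finite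
  ... | inj₂ (g , g-injective) =
    let i , j , i<j , eq = pigeonhole (n<1+n N) (λ i → f (g (toℕ i))) in
    ⊥-elim (Fin.<-irrefl (toℕ-injective (g-injective (f-injective eq))) i<j)

  module _ {B : Set} {g : ℕ → B} (g-injective : Injective _≡_ _≡_ g) where

    Tail : ℕ → B → Set
    Tail i b = Σ ℕ λ j → i ≤ j × g j ≡ b

    tail-exhaustion : Exhaustion B
    tail-exhaustion = record
      { Part           = λ i → Sub (λ b → ¬ Tail i b)
      ; incl           = λ _ → proj₁
      ; incl-injective = λ _ → Sub-≡
      ; next           = λ i → λ { (b , ¬tail) → b , fromWitness λ { (j , 1+i≤j , eq) →
                                   toWitness ¬tail (j , ≤-trans (n≤1+n i) 1+i≤j , eq) } }
      ; incl-next      = λ _ _ → refl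
      ; covering       = covering
      }
      where
      covering : ∀ b → Σ ℕ λ i → Σ (Sub (λ b → ¬ Tail i b)) λ a → proj₁ a ≡ b
      covering b with lem {Σ ℕ λ j → g j ≡ b}
      ... | yes (j , refl) = suc j , (g j , fromWitness λ { (j′ , j<j′ , eq) →
                                         <-irrefl (sym (g-injective eq)) j<j′ }) , refl
      ... | no  ¬hit       = 0 , (b , fromWitness λ { (j , _ , eq) → ¬hit (j , eq) }) , refl

    tail-exhaustion-unbounded : ∀ i → ¬ StrictlySurjective _≡_ (Exhaustion.incl tail-exhaustion i)
    tail-exhaustion-unbounded i onto with onto (g i)
    ... | (_ , ¬tail) , eq = toWitness ¬tail (i , ≤-refl , sym eq)

module FiniteObjects (lem : ExcludedMiddle 0ℓ) (𝕊 : Set) where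
  open ChuDefs 𝕊
  open Classical lem

  injective∧surjective⇒mono : ∀ {C D} (φ : Hom C D) →
    Injective _≡_ _≡_ (f⁺ φ) → StrictlySurjective _≡_ (f⁻ φ) → IsMono φ
  injective∧surjective⇒mono φ φ⁺-injective φ⁻-surjective g h (eq⁺ , eq⁻) =
    (λ a → φ⁺-injective (eq⁺ a)) ,
    (λ x → let y , φ⁻y≡x = φ⁻-surjective x in
           subst (λ x → f⁻ g x ≡ f⁻ h x) φ⁻y≡x (eq⁻ y))

  mono⇒surjective : ∀ {C D} (φ : Hom C D) → IsMono φ → StrictlySurjective _≡_ (f⁻ φ)
  mono⇒surjective {C} {D} φ mono x = toWitness (subst T (proj₂ (mono always in-image agree) x) tt)
    where
    Probe : Chu
    Probe = chu ⊥ Bool (λ ())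
    always in-image : Hom Probe C
    always   = hom (λ ()) (λ _ → true) (λ ())
    in-image = hom (λ ()) (λ x → isYes (lem {Σ (X D) λ y → f⁻ φ y ≡ x})) (λ ())
    agree : (φ ∘ always) ≈ (φ ∘ in-image)
    agree = (λ ()) , λ y → sym (Equivalence.to T-≡ (fromWitness (y , refl)))

  mono⇒injective : ∀ {C D} (φ : Hom C D) → IsMono φ → Injective _≡_ _≡_ (f⁺ φ)
  mono⇒injective {C} {D} φ mono {a} {a′} φa≡φa′ =
    proj₁ (mono at-a at-a′ ((λ _ → φa≡φa′) , λ _ → refl)) tt
    where
    same-row : ∀ x → r C a′ x ≡ r C a x
    same-row x with mono⇒surjective φ mono x
    ... | y , refl =
      trans (sym (adj φ a′ y)) (trans (cong (λ c → r D c y) (sym φa≡φa′)) (adj φ a y))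
    Row : Chu
    Row = chu ⊤ (X C) (λ _ → r C a)
    at-a at-a′ : Hom Row C
    at-a  = hom (λ _ → a)  (λ x → x) (λ _ _ → refl)
    at-a′ = hom (λ _ → a′) (λ x → x) (λ _ → same-row)

  embedding : ∀ {C D} (φ : Hom C D) →
    Injective _≡_ _≡_ (f⁺ φ) → StrictlySurjective _≡_ (f⁻ φ) → iHom C D
  embedding φ φ⁺-injective φ⁻-surjective =
    ihom φ (injective∧surjective⇒mono φ φ⁺-injective φ⁻-surjective)

  ⁺-injective : ∀ {C D} (φ : iHom C D) → Injective _≡_ _≡_ (f⁺ (mor φ))
  ⁺-injective φ = mono⇒injective (mor φ) (mono φ)

  ⁻-surjective : ∀ {C D} (φ : iHom C D) → StrictlySurjective _≡_ (f⁻ (mor φ))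
  ⁻-surjective φ = mono⇒surjective (mor φ) (mono φ)

  id-iHom : ∀ C → iHom C C
  id-iHom C = embedding (hom (λ a → a) (λ x → x) (λ _ _ → refl)) (λ eq → eq) (λ x → x , refl)

  _∘ᵢ_ : ∀ {C D E} → iHom D E → iHom C D → iHom C E
  ψ ∘ᵢ φ = ihom (mor ψ ∘ mor φ)
    (λ g h eq → mono φ g h (mono ψ (mor φ ∘ g) (mor φ ∘ h) eq))

  module _ {S : ωSeq} where

    leg⁺ : ∀ {C} → Cocone S C → ∀ i → A (obj S i) → A C
    leg⁺ K i = f⁺ (mor (leg K i))

    leg⁻ : ∀ {C} → Cocone S C → ∀ i → X C → X (obj S i)
    leg⁻ K i = f⁻ (mor (leg K i))

    forward : ∀ {i M} → i ≤′ M → A (obj S i) → A (obj S M)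
    forward ≤′-refl     a = a
    forward (≤′-step p) a = f⁺ (mor (step S _)) (forward p a)

    leg⁺-forward : ∀ {C} (K : Cocone S C) {i M} (p : i ≤′ M) a →
      leg⁺ K M (forward p a) ≡ leg⁺ K i a
    leg⁺-forward K ≤′-refl     a = refl
    leg⁺-forward K (≤′-step p) a = trans (proj₁ (commute K _) (forward p a)) (leg⁺-forward K p a)

    -- Any two points of the sequence meet at the stage i ⊔ i′, where legs are injective.
    leg⁺-coherent : ∀ {C C′} (K : Cocone S C) (K′ : Cocone S C′) {i i′ a a′} →
      leg⁺ K i a ≡ leg⁺ K i′ a′ → leg⁺ K′ i a ≡ leg⁺ K′ i′ a′
    leg⁺-coherent K K′ {i} {i′} {a} {a′} eq = begin
      leg⁺ K′ i a                ≡⟨ sym (leg⁺-forward K′ p a) ⟩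
      leg⁺ K′ M (forward p a)    ≡⟨ cong (leg⁺ K′ M) (⁺-injective (leg K M) meet) ⟩
      leg⁺ K′ M (forward p′ a′)  ≡⟨ leg⁺-forward K′ p′ a′ ⟩
      leg⁺ K′ i′ a′              ∎
      where
      M : ℕ
      M = i ⊔ i′
      p : i ≤′ M
      p = ≤⇒≤′ (m≤m⊔n i i′)
      p′ : i′ ≤′ M
      p′ = ≤⇒≤′ (m≤n⊔m i i′)
      meet : leg⁺ K M (forward p a) ≡ leg⁺ K M (forward p′ a′)
      meet = trans (leg⁺-forward K p a) (trans eq (sym (leg⁺-forward K p′ a′)))

  module _ (F : Chu) (E : Exhaustion (A F)) where
    open Exhaustion E

    restriction : ℕ → Chu
    restriction i = chu (Part i) (X F) (λ a → r F (incl i a))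

    restrictions : ωSeq
    restrictions = record { obj = restriction ; step = next-iHom }
      where
      next-iHom : ∀ i → iHom (restriction i) (restriction (suc i))
      next-iHom i = embedding
        (hom (next i) (λ x → x) (λ a x → cong (λ b → r F b x) (incl-next i a)))
        (λ eq → incl-injective i
                  (trans (sym (incl-next i _)) (trans (cong (incl (suc i)) eq) (incl-next i _))))
        (λ x → x , refl)

    inclusions : Cocone restrictions F
    inclusions = record
      { leg     = λ i → embedding (hom (incl i) (λ x → x) (λ _ _ → refl))
                                  (incl-injective i) (λ x → x , refl)
      ; commute = λ i → incl-next i , λ _ → refl
      }

    restrictions-colimit : IsColimit restrictions F inclusions
    restrictions-colimit C′ K′ =
      embedding ψ ψ⁺-injective (⁻-surjective (leg K′ 0)) , factors , unique
      where
      leg⁻-constant : ∀ i z → leg⁻ K′ i z ≡ leg⁻ K′ 0 z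
      leg⁻-constant zero    z = refl
      leg⁻-constant (suc i) z = trans (proj₂ (commute K′ i) z) (leg⁻-constant i z)

      ψ⁺ : A F → A C′
      ψ⁺ b = leg⁺ K′ (proj₁ (covering b)) (proj₁ (proj₂ (covering b)))

      ψ⁺-incl : ∀ i a → ψ⁺ (incl i a) ≡ leg⁺ K′ i a
      ψ⁺-incl i a = leg⁺-coherent inclusions K′ (proj₂ (proj₂ (covering (incl i a))))

      ψ : Hom F C′
      ψ = hom ψ⁺ (leg⁻ K′ 0) (by-stage λ i a z → begin
        r C′ (ψ⁺ (incl i a)) z        ≡⟨ cong (λ c → r C′ c z) (ψ⁺-incl i a) ⟩
        r C′ (leg⁺ K′ i a) z          ≡⟨ adj (mor (leg K′ i)) a z ⟩
        r F (incl i a) (leg⁻ K′ i z)  ≡⟨ cong (r F (incl i a)) (leg⁻-constant i z) ⟩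
        r F (incl i a) (leg⁻ K′ 0 z)  ∎)

      ψ⁺-injective : Injective _≡_ _≡_ ψ⁺
      ψ⁺-injective {b} {b′} = by-stage {λ b → ∀ b′ → ψ⁺ b ≡ ψ⁺ b′ → b ≡ b′}
        (λ i a → by-stage λ i′ a′ eq → leg⁺-coherent K′ inclusions
          (trans (sym (ψ⁺-incl i a)) (trans eq (ψ⁺-incl i′ a′)))) b b′

      factors : ∀ i → (ψ ∘ mor (leg inclusions i)) ≈ mor (leg K′ i)
      factors i = ψ⁺-incl i , λ z → sym (leg⁻-constant i z)

      unique : ∀ (ψ′ : iHom F C′) →
        (∀ i → (mor ψ′ ∘ mor (leg inclusions i)) ≈ mor (leg K′ i)) → mor ψ′ ≈ ψ
      unique ψ′ ψ′-factors =
        by-stage (λ i a → trans (proj₁ (ψ′-factors i) a) (sym (ψ⁺-incl i a))) ,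
        proj₂ (ψ′-factors 0)

    finite-object⇒exhaustion-stops : FiniteObject F → Σ ℕ λ i → StrictlySurjective _≡_ (incl i)
    finite-object⇒exhaustion-stops finite-object
      with finite-object restrictions F inclusions restrictions-colimit (id-iHom F)
    ... | i , ψ , eq⁺ , _ = i , λ b → f⁺ (mor ψ) b , sym (eq⁺ b)

  finite-object⇒finite-points : (F : Chu) → FiniteObject F → Finite (A F)
  finite-object⇒finite-points F finite-object with finite⊎ℕ-injection (A F)
  ... | inj₁ finite = finite
  ... | inj₂ (g , g-injective)
    with finite-object⇒exhaustion-stops F (tail-exhaustion g-injective) finite-object
  ...   | i , onto = ⊥-elim (tail-exhaustion-unbounded g-injective i onto)

  copies : Chu → Set → Chu
  copies F I = chu (A F) (X F × I) (λ a w → r F a (proj₁ w))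

  copies-map : ∀ {F I J} (f : J → I) → StrictlySurjective _≡_ f → iHom (copies F I) (copies F J)
  copies-map f f-surjective = embedding (hom (λ a → a) (map₂ f) (λ _ _ → refl)) (λ eq → eq)
    λ { (y , i) → let j , fj≡i = f-surjective i in (y , j) , cong (y ,_) fj≡i }

  module _ (F : Chu) (I : InverseLimit) where
    open InverseLimit I

    copies-sequence : ωSeq
    copies-sequence = record
      { obj  = λ k → copies F (Stage k)
      ; step = λ k → copies-map (restrict k) (restrict-surjective k)
      }

    projections : Cocone copies-sequence (copies F Limit)
    projections = record
      { leg     = λ k → copies-map (project k) (project-surjective k)
      ; commute = λ k → (λ _ → refl) , λ w → cong (proj₁ w ,_) (restrict-project k (proj₂ w))
      }

    copies-separated : ∀ (w : X F × Limit) y l →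
      map₂ (project (proj₁ (separated l))) w ≡ (y , project _ l) → w ≡ (y , l)
    copies-separated (y′ , l′) y l eq =
      cong₂ _,_ (cong proj₁ eq) (proj₂ (separated l) l′ (cong proj₂ eq))

    copies-colimit : IsColimit copies-sequence (copies F Limit) projections
    copies-colimit C′ K′ = embedding ψ (⁺-injective (leg K′ 0)) ψ⁻-surjective , factors , unique
      where
      module _ (z : X C′) where
        state-constant : ∀ k → proj₁ (leg⁻ K′ k z) ≡ proj₁ (leg⁻ K′ 0 z)
        state-constant zero    = refl
        state-constant (suc k) = trans (cong proj₁ (proj₂ (commute K′ k) z)) (state-constant k)

        limit : Σ Limit λ l → ∀ k → project k l ≡ proj₂ (leg⁻ K′ k z)
        limit = complete (λ k → proj₂ (leg⁻ K′ k z))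
                         (λ k → cong proj₂ (proj₂ (commute K′ k) z))

      ψ⁻ : X C′ → X F × Limit
      ψ⁻ z = proj₁ (leg⁻ K′ 0 z) , proj₁ (limit z)

      ψ⁻-projects : ∀ k z → map₂ (project k) (ψ⁻ z) ≡ leg⁻ K′ k z
      ψ⁻-projects k z = cong₂ _,_ (sym (state-constant z k)) (proj₂ (limit z) k)

      ψ : Hom (copies F Limit) C′
      ψ = hom (leg⁺ K′ 0) ψ⁻ (adj (mor (leg K′ 0)))

      ψ⁻-surjective : StrictlySurjective _≡_ ψ⁻
      ψ⁻-surjective (y , l) with ⁻-surjective (leg K′ (proj₁ (separated l))) (y , project _ l)
      ... | z , eq = z , copies-separated (ψ⁻ z) y l (trans (ψ⁻-projects _ z) eq)

      leg⁺-constant : ∀ k a → leg⁺ K′ k a ≡ leg⁺ K′ 0 a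
      leg⁺-constant zero    a = refl
      leg⁺-constant (suc k) a = trans (proj₁ (commute K′ k) a) (leg⁺-constant k a)

      factors : ∀ k → (ψ ∘ mor (leg projections k)) ≈ mor (leg K′ k)
      factors k = (λ a → sym (leg⁺-constant k a)) , ψ⁻-projects k

      unique : ∀ (ψ′ : iHom (copies F Limit) C′) →
        (∀ k → (mor ψ′ ∘ mor (leg projections k)) ≈ mor (leg K′ k)) → mor ψ′ ≈ ψ
      unique ψ′ ψ′-factors = proj₁ (ψ′-factors 0) , λ z →
        copies-separated (f⁻ (mor ψ′) z) _ _
          (trans (proj₂ (ψ′-factors _) z) (sym (ψ⁻-projects _ z)))

  module _ (F : Chu) {x₀ y₀ : X F} (same-column : ∀ a → r F a x₀ ≡ r F a y₀) where

    replace : X F → X F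
    replace y with lem {y ≡ x₀}
    ... | yes _ = y₀
    ... | no  _ = y

    replace-x₀ : replace x₀ ≡ y₀
    replace-x₀ with lem {x₀ ≡ x₀}
    ... | yes _  = refl
    ... | no  ≢x₀ = ⊥-elim (≢x₀ refl)

    replace-row : ∀ a y → r F a y ≡ r F a (replace y)
    replace-row a y with lem {y ≡ x₀}
    ... | yes refl = same-column a
    ... | no  _    = refl

    twist : iHom F (copies F (ℕ × Bool))
    twist = embedding (hom (λ a → a) twist⁻ twist-adj) (λ eq → eq) (λ y → (y , 0 , false) , refl)
      where
      twist⁻ : X F × ℕ × Bool → X F
      twist⁻ (y , _ , false) = y
      twist⁻ (y , _ , true)  = replace y
      twist-adj : ∀ a w → r F a (proj₁ w) ≡ r F a (twist⁻ w)
      twist-adj a (y , _ , false) = refl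
      twist-adj a (y , _ , true)  = replace-row a y

  finite-object⇒extensional : (F : Chu) → FiniteObject F → Extensional F
  finite-object⇒extensional F finite-object x₀ y₀ same-column
    with finite-object (copies-sequence F blurring) (copies F (ℕ × Bool)) (projections F blurring)
                       (copies-colimit F blurring) (twist F same-column)
  ... | i , ψ , _ , twist≈ψ∘π = begin
    x₀                                    ≡⟨ twist≈ψ∘π (x₀ , i , false) ⟩
    f⁻ (mor ψ) (x₀ , blur i (i , false))  ≡⟨ cong (λ s → f⁻ (mor ψ) (x₀ , s)) invisible ⟩
    f⁻ (mor ψ) (x₀ , blur i (i , true))   ≡⟨ sym (twist≈ψ∘π (x₀ , i , true)) ⟩
    replace F same-column x₀              ≡⟨ replace-x₀ F same-column ⟩
    y₀                                    ∎
    where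
    invisible : blur i (i , false) ≡ blur i (i , true)
    invisible = blur-invisible false true ≤-refl

  module _ {S : ωSeq} {C : Chu} (K : Cocone S C) where

    InImage : A C → Set
    InImage c = Σ ℕ λ i → Σ (A (obj S i)) λ a → leg⁺ K i a ≡ c

    -- The union of the images of the legs is a subobject through which K factors; the
    -- universal property makes the resulting endomorphism of C the identity.
    colimit-legs-cover : IsColimit S C K → ∀ c → InImage c
    colimit-legs-cover colimit c = subst InImage (retract c) (toWitness (proj₂ (f⁺ (mor ψ) c)))
      where
      Image : Chu
      Image = chu (Sub InImage) (X C) (λ p → r C (proj₁ p))

      corestriction : Cocone S Image
      corestriction = record
        { leg     = λ i → embedding
                      (hom (λ a → leg⁺ K i a , fromWitness (i , a , refl))
                           (leg⁻ K i) (adj (mor (leg K i))))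
                      (λ eq → ⁺-injective (leg K i) (cong proj₁ eq)) (⁻-surjective (leg K i))
        ; commute = λ i → (λ a → Sub-≡ (proj₁ (commute K i) a)) , proj₂ (commute K i)
        }

      inclusion : iHom Image C
      inclusion = embedding (hom proj₁ (λ x → x) (λ _ _ → refl)) Sub-≡ (λ x → x , refl)

      ψ : iHom C Image
      ψ = proj₁ (colimit Image corestriction)

      ψ-factors : ∀ i → (mor ψ ∘ mor (leg K i)) ≈ mor (leg corestriction i)
      ψ-factors = proj₁ (proj₂ (colimit Image corestriction))

      unique : ∀ (ψ′ : iHom C C) → (∀ i → (mor ψ′ ∘ mor (leg K i)) ≈ mor (leg K i)) →
               mor ψ′ ≈ mor (proj₁ (colimit C K))
      unique = proj₂ (proj₂ (colimit C K))

      retract : ∀ c → proj₁ (f⁺ (mor ψ) c) ≡ c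
      retract c = trans (proj₁ (unique (inclusion ∘ᵢ ψ) through-image) c)
                        (sym (proj₁ (unique (id-iHom C) (λ _ → (λ _ → refl) , (λ _ → refl))) c))
        where
        through-image : ∀ i → (mor (inclusion ∘ᵢ ψ) ∘ mor (leg K i)) ≈ mor (leg K i)
        through-image i = (λ a → cong proj₁ (proj₁ (ψ-factors i) a)) , proj₂ (ψ-factors i)

  module _ {F C D : Chu} (extensional : Extensional F) (φ : iHom F C) (ι : iHom D C)
           (lift : ∀ b → Σ (A D) λ a → f⁺ (mor ι) a ≡ f⁺ (mor φ) b) where

    private
      ψ⁺ : A F → A D
      ψ⁺ b = proj₁ (lift b)

      entry : ∀ b x → r F b (f⁻ (mor φ) x) ≡ r D (ψ⁺ b) (f⁻ (mor ι) x)
      entry b x = begin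
        r F b (f⁻ (mor φ) x)           ≡⟨ sym (adj (mor φ) b x) ⟩
        r C (f⁺ (mor φ) b) x           ≡⟨ cong (λ c → r C c x) (sym (proj₂ (lift b))) ⟩
        r C (f⁺ (mor ι) (ψ⁺ b)) x      ≡⟨ adj (mor ι) (ψ⁺ b) x ⟩
        r D (ψ⁺ b) (f⁻ (mor ι) x)      ∎

      φ⁻-respects-ι⁻ : ∀ {x x′} →
        f⁻ (mor ι) x ≡ f⁻ (mor ι) x′ → f⁻ (mor φ) x ≡ f⁻ (mor φ) x′
      φ⁻-respects-ι⁻ {x} {x′} eq = extensional _ _ λ b →
        trans (entry b x) (trans (cong (r D (ψ⁺ b)) eq) (sym (entry b x′)))

      ι⁻-preimage : ∀ y → Σ (X C) λ x → f⁻ (mor ι) x ≡ y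
      ι⁻-preimage = ⁻-surjective ι

      ψ⁻ : X D → X F
      ψ⁻ y = f⁻ (mor φ) (proj₁ (ι⁻-preimage y))

      ψ⁻-ι⁻ : ∀ x → ψ⁻ (f⁻ (mor ι) x) ≡ f⁻ (mor φ) x
      ψ⁻-ι⁻ x = φ⁻-respects-ι⁻ (proj₂ (ι⁻-preimage (f⁻ (mor ι) x)))

      ψ : Hom F D
      ψ = hom ψ⁺ ψ⁻ λ b y →
        sym (trans (entry b _) (cong (r D (ψ⁺ b)) (proj₂ (ι⁻-preimage y))))

      ψ⁺-injective : Injective _≡_ _≡_ ψ⁺
      ψ⁺-injective {b} {b′} eq = ⁺-injective φ
        (trans (sym (proj₂ (lift b))) (trans (cong (f⁺ (mor ι)) eq) (proj₂ (lift b′))))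

      ψ⁻-surjective : StrictlySurjective _≡_ ψ⁻
      ψ⁻-surjective y with ⁻-surjective φ y
      ... | x , eq = f⁻ (mor ι) x , trans (ψ⁻-ι⁻ x) eq

    extensional-factor : Σ (iHom F D) λ ψ → mor φ ≈ (mor ι ∘ mor ψ)
    extensional-factor = embedding ψ ψ⁺-injective ψ⁻-surjective ,
                         (λ b → sym (proj₂ (lift b))) , (λ x → sym (ψ⁻-ι⁻ x))

  finite∧extensional⇒finite-object : (F : Chu) → Finite (A F) → Extensional F → FiniteObject F
  finite∧extensional⇒finite-object F finite extensional S C K colimit φ =
    M , extensional-factor extensional φ (leg K M) lift
    where
    stage : A F → ℕ
    stage b = proj₁ (colimit-legs-cover K colimit (f⁺ (mor φ) b))

    M : ℕ
    M = proj₁ (finite-bounded finite stage)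

    lift : ∀ b → Σ (A (obj S M)) λ a → leg⁺ K M a ≡ f⁺ (mor φ) b
    lift b = forward {S} M-bound (proj₁ (proj₂ cover)) ,
             trans (leg⁺-forward K M-bound _) (proj₂ (proj₂ cover))
      where
      cover : InImage K (f⁺ (mor φ) b)
      cover = colimit-legs-cover K colimit (f⁺ (mor φ) b)
      M-bound : stage b ≤′ M
      M-bound = ≤⇒≤′ (proj₂ (finite-bounded finite stage) b)

  extensional⇒states↣columns : (F : Chu) → Extensional F → X F ↣ (A F → 𝕊)
  extensional⇒states↣columns F extensional =
    mk↣ λ eq → extensional _ _ λ a → cong (λ column → column a) eq

  extensional⇒finite-states : (F : Chu) → Finite (A F) → Extensional F → Finite 𝕊 → Finite (X F)
  extensional⇒finite-states F (n , A↔Fin) extensional (m , 𝕊↔Fin) =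
    injection-into-Fin⇒finite code λ {x} {y} eq → extensional x y λ a → begin
      r F a x           ≡⟨ sym (decode-code x a) ⟩
      decode (code x) a ≡⟨ cong (λ c → decode c a) eq ⟩
      decode (code y) a ≡⟨ decode-code y a ⟩
      r F a y           ∎
    where
    module A = Inverse A↔Fin
    module 𝕊 = Inverse 𝕊↔Fin

    code : X F → Fin (m ^ n)
    code x = funToFin λ i → 𝕊.to (r F (A.from i) x)

    decode : Fin (m ^ n) → A F → 𝕊
    decode c a = 𝕊.from (finToFun c (A.to a))

    decode-code : ∀ x a → decode (code x) a ≡ r F a x
    decode-code x a = begin
      𝕊.from (finToFun (code x) (A.to a))       ≡⟨ cong 𝕊.from (finToFun-funToFin _ (A.to a)) ⟩
      𝕊.from (𝕊.to (r F (A.from (A.to a)) x))   ≡⟨ 𝕊.strictlyInverseʳ _ ⟩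
      r F (A.from (A.to a)) x                   ≡⟨ cong (λ a′ → r F a′ x) (A.strictlyInverseʳ _) ⟩
      r F a x                                   ∎

theorem4p1 : ExcludedMiddle 0ℓ →
    (𝕊 : Set) (𝟘 𝟙 : 𝕊) → 𝟘 ≢ 𝟙 →
    (F : ChuDefs.Chu 𝕊) →
    (ChuDefs.FiniteObject 𝕊 F ⇔ (Finite (ChuDefs.A F) × ChuDefs.Extensional 𝕊 F))
    × (ChuDefs.FiniteObject 𝕊 F → (ChuDefs.X F ↣ (ChuDefs.A F → 𝕊)))
    × (ChuDefs.FiniteObject 𝕊 F → Finite 𝕊 → Finite (ChuDefs.X F))
theorem4p1 lem 𝕊 _ _ _ F =
  mk⇔ (λ finite-object → finite-points finite-object , extensional finite-object)
      (λ (finite , ext) → finite∧extensional⇒finite-object F finite ext) ,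
  (λ finite-object → extensional⇒states↣columns F (extensional finite-object)) ,
  (λ finite-object →
     extensional⇒finite-states F (finite-points finite-object) (extensional finite-object))
  where
  open ChuDefs 𝕊 using (FiniteObject; A; Extensional)
  open FiniteObjects lem 𝕊
  finite-points : FiniteObject F → Finite (A F)
  finite-points = finite-object⇒finite-points F
  extensional : FiniteObject F → Extensional F
  extensional = finite-object⇒extensional F
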